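{- Let $P$ be a path with vertices $v_0,v_1,\dots,v_\ell$ ($\ell\ge 1$) and edges $v_{i-1}v_i$. Suppose some of the edges of $P$ have been directed so that no internal vertex $v_1,\dots,v_{\ell-1}$ is a sink or a source (the end vertices $v_0,v_\ell$ are exempt from this rule), that both end edges $v_0v_1$ and $v_{\ell-1}v_\ell$ are directed, and that no undirected edge of $P$ can be directed (in either direction) without making some internal vertex a sink or a source. Then the number of undirected (unmarkable) edges of $P$ is even if the two end edges point in the same direction along $P$ (both from the $v_0$ side towards the $v_\ell$ side, or both the other way), and odd if they point in opposite directions along $P$.
   Context: A vertex is a sink if all edges incident to it are directed into it, and a source if all edges incident to it are directed out of it. An undirected edge is unmarkable if directing it in either direction would create a sink or a source. -}

module Defs where

open import Data.Nat using (ℕ; suc)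
open import Data.Fin using (Fin; toℕ; _≟_)
open import Data.List using (List; length; filter; allFin)
open import Data.Product using (Σ; _×_)
open import Data.Sum using (_⊎_)
open import Relation.Nullary using (¬_; Dec; yes; no)
open import Relation.Binary.PropositionalEquality using (_≡_; refl)

-- The path has vertices v₀,…,v_ℓ and
-- edges indexed by k : Fin ℓ, edge k joining v_k and v_{k+1}.
--   fwd   : directed v_k → v_{k+1}
--   bwd   : directed v_{k+1} → v_k
--   undir : not directed
data Dir : Set where
  undir fwd bwd : Dir

_≟D_ : (a b : Dir) → Dec (a ≡ b)
undir ≟D undir = yes refl
undir ≟D fwd = no λ ()
undir ≟D bwd = no λ ()
fwd ≟D undir = no λ ()
fwd ≟D fwd = yes refl
fwd ≟D bwd = no λ ()
bwd ≟D undir = no λ ()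
bwd ≟D fwd = no λ ()
bwd ≟D bwd = yes refl

Orientation : ℕ → Set
Orientation ℓ = Fin ℓ → Dir

-- Edges i and j are consecutive: they share the internal vertex v_{i+1}.
-- Every internal vertex v_1,…,v_{ℓ-1} arises this way exactly once.
Consecutive : ∀ {ℓ} → Fin ℓ → Fin ℓ → Set
Consecutive i j = toℕ j ≡ suc (toℕ i)

SinkAt : ∀ {ℓ} → Orientation ℓ → Fin ℓ → Fin ℓ → Set
SinkAt o i j = (o i ≡ fwd) × (o j ≡ bwd)

SourceAt : ∀ {ℓ} → Orientation ℓ → Fin ℓ → Fin ℓ → Set
SourceAt o i j = (o i ≡ bwd) × (o j ≡ fwd)

NoInternalSinkSource : ∀ {ℓ} → Orientation ℓ → Set
NoInternalSinkSource o =
  ∀ i j → Consecutive i j → ¬ SinkAt o i j × ¬ SourceAt o i j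

HasInternalSinkSource : ∀ {ℓ} → Orientation ℓ → Set
HasInternalSinkSource {ℓ} o =
  Σ (Fin ℓ) λ i → Σ (Fin ℓ) λ j → Consecutive i j × (SinkAt o i j ⊎ SourceAt o i j)

setEdge : ∀ {ℓ} → Orientation ℓ → Fin ℓ → Dir → Orientation ℓ
setEdge o k d j with j ≟ k
... | yes _ = d
... | no _ = o j

Unmarkable : ∀ {ℓ} → Orientation ℓ → Fin ℓ → Set
Unmarkable o k =
  (o k ≡ undir)
  × HasInternalSinkSource (setEdge o k fwd)
  × HasInternalSinkSource (setEdge o k bwd)

numUndirected : ∀ {ℓ} → Orientation ℓ → ℕ
numUndirected {ℓ} o = length (filter (λ k → o k ≟D undir) (allFin ℓ))

{-# OPTIONS --safe #-}
-- With no internal sink or source, two adjacent directed edges point the same way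
-- along the path.  Directing an undirected edge can only create a sink or source at one
-- of its own two endpoints, so an undirected edge is unmarkable exactly when its two
-- neighbours are directed and point in opposite ways; in particular no two undirected
-- edges are adjacent.  Walking along the path, the direction is therefore kept across
-- every vertex next to a directed edge and reversed across every undirected edge, so the
-- last edge is the first one reversed once per undirected edge.
module Submission where

open import Defs
open import Data.Nat using (ℕ; zero; suc; _%_)
open import Data.Nat.Properties using (suc-injective; 1+n≢n)
open import Data.Fin using (Fin; zero; suc; fromℕ; toℕ; _≟_)
open import Data.Fin.Properties using (toℕ-injective)
open import Data.List using (_∷_; []; length; filter; map; tabulate; allFin)
open import Data.List.Properties using (filter-accept; filter-reject; map-tabulate)
open import Data.Product using (_×_; _,_; proj₁; proj₂)
open import Data.Sum using (_⊎_; inj₁; inj₂; [_,_])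
open import Data.Empty using (⊥-elim)
open import Function using (_∘_)
open import Relation.Nullary using (¬_; yes; no)
open import Relation.Unary using (Pred; Decidable)
open import Relation.Binary.PropositionalEquality
  using (_≡_; _≢_; refl; sym; trans; cong; subst₂; module ≡-Reasoning)

reverse : Dir → Dir
reverse undir = undir
reverse fwd   = bwd
reverse bwd   = fwd

reverse-involutive : ∀ d → reverse (reverse d) ≡ d
reverse-involutive undir = refl
reverse-involutive fwd   = refl
reverse-involutive bwd   = refl

directed⇒≢reverse : ∀ {d} → d ≢ undir → d ≢ reverse d
directed⇒≢reverse {undir} d≢undir _ = d≢undir refl
directed⇒≢reverse {fwd}   _ ()
directed⇒≢reverse {bwd}   _ ()

reverse^ : ℕ → Dir → Dir
reverse^ zero    d = d
reverse^ (suc c) d = reverse^ c (reverse d)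

reverse^-%2 : ∀ c d → reverse^ c d ≡ reverse^ (c % 2) d
-- The last clause needs no arithmetic: (2 + c) % 2 reduces to c % 2.
reverse^-%2 zero          d = refl
reverse^-%2 (suc zero)    d = refl
reverse^-%2 (suc (suc c)) d rewrite reverse-involutive d = reverse^-%2 c d

%2≡0⊎%2≡1 : ∀ c → c % 2 ≡ 0 ⊎ c % 2 ≡ 1
%2≡0⊎%2≡1 zero          = inj₁ refl
%2≡0⊎%2≡1 (suc zero)    = inj₂ refl
%2≡0⊎%2≡1 (suc (suc c)) = %2≡0⊎%2≡1 c

reverse^-parity : ∀ c {d} → d ≢ undir
                → (d ≡ reverse^ c d → c % 2 ≡ 0) × (d ≢ reverse^ c d → c % 2 ≡ 1)
reverse^-parity c {d} d≢undir rewrite reverse^-%2 c d with %2≡0⊎%2≡1 c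
... | inj₁ even rewrite even = (λ _ → refl) , (λ d≢d → ⊥-elim (d≢d refl))
... | inj₂ odd  rewrite odd  =
  (λ d≡rev → ⊥-elim (directed⇒≢reverse d≢undir d≡rev)) , (λ _ → refl)

data Opposite : Dir → Dir → Set where
  fwd-bwd : Opposite fwd bwd
  bwd-fwd : Opposite bwd fwd

opposite⇒≡reverse : ∀ {x y} → Opposite x y → y ≡ reverse x
opposite⇒≡reverse fwd-bwd = refl
opposite⇒≡reverse bwd-fwd = refl

opposite⇒directedʳ : ∀ {x y} → Opposite x y → y ≢ undir
opposite⇒directedʳ fwd-bwd ()
opposite⇒directedʳ bwd-fwd ()

directed∧¬opposite⇒≡ : ∀ {x y} → x ≢ undir → y ≢ undir → ¬ Opposite x y → x ≡ y
directed∧¬opposite⇒≡ {undir} {_}     x≢undir _       _ = ⊥-elim (x≢undir refl)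
directed∧¬opposite⇒≡ {_}     {undir} _       y≢undir _ = ⊥-elim (y≢undir refl)
directed∧¬opposite⇒≡ {fwd}   {fwd}   _ _ _ = refl
directed∧¬opposite⇒≡ {bwd}   {bwd}   _ _ _ = refl
directed∧¬opposite⇒≡ {fwd}   {bwd}   _ _ ¬opp = ⊥-elim (¬opp fwd-bwd)
directed∧¬opposite⇒≡ {bwd}   {fwd}   _ _ ¬opp = ⊥-elim (¬opp bwd-fwd)

-- x and y are the directions of the two neighbours of an edge that cannot be directed
-- either way without becoming opposite to one of them.
opposite-of-both : ∀ {x y} → Opposite x fwd ⊎ Opposite fwd y → Opposite x bwd ⊎ Opposite bwd y
                 → Opposite x y
opposite-of-both (inj₁ bwd-fwd) (inj₁ ())
opposite-of-both (inj₁ bwd-fwd) (inj₂ bwd-fwd) = bwd-fwd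
opposite-of-both (inj₂ fwd-bwd) (inj₁ fwd-bwd) = fwd-bwd
opposite-of-both (inj₂ fwd-bwd) (inj₂ ())

sinkOrSource⇔opposite : ∀ {x y} → ((x ≡ fwd × y ≡ bwd) ⊎ (x ≡ bwd × y ≡ fwd) → Opposite x y)
                                × (Opposite x y → (x ≡ fwd × y ≡ bwd) ⊎ (x ≡ bwd × y ≡ fwd))
sinkOrSource⇔opposite = to , from
  where
  to : ∀ {x y} → (x ≡ fwd × y ≡ bwd) ⊎ (x ≡ bwd × y ≡ fwd) → Opposite x y
  to (inj₁ (refl , refl)) = fwd-bwd
  to (inj₂ (refl , refl)) = bwd-fwd
  from : ∀ {x y} → Opposite x y → (x ≡ fwd × y ≡ bwd) ⊎ (x ≡ bwd × y ≡ fwd)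
  from fwd-bwd = inj₁ (refl , refl)
  from bwd-fwd = inj₂ (refl , refl)

noSinkSource⇒¬opposite : ∀ {ℓ} {o : Orientation ℓ} → NoInternalSinkSource o
                       → ∀ {i j} → Consecutive i j → ¬ Opposite (o i) (o j)
noSinkSource⇒¬opposite none {i} {j} cij opp =
  [ proj₁ (none i j cij) , proj₂ (none i j cij) ] (proj₂ sinkOrSource⇔opposite opp)

consecutive-injectiveʳ : ∀ {ℓ} {i j k : Fin ℓ} → Consecutive i j → Consecutive i k → j ≡ k
consecutive-injectiveʳ cij cik = toℕ-injective (trans cij (sym cik))

consecutive-injectiveˡ : ∀ {ℓ} {i j k : Fin ℓ} → Consecutive i k → Consecutive j k → i ≡ j
consecutive-injectiveˡ cik cjk = toℕ-injective (suc-injective (trans (sym cik) cjk))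

setEdge-updated : ∀ {ℓ} (o : Orientation ℓ) k d → setEdge o k d k ≡ d
setEdge-updated o k d with k ≟ k
... | yes _   = refl
... | no k≢k = ⊥-elim (k≢k refl)

setEdge-unchanged : ∀ {ℓ} (o : Orientation ℓ) {j k} d → j ≢ k → setEdge o k d j ≡ o j
setEdge-unchanged o {j} {k} d j≢k with j ≟ k
... | yes j≡k = ⊥-elim (j≢k j≡k)
... | no _    = refl

setEdge-sinkSource⇒opposite-neighbour
  : ∀ {ℓ} {o : Orientation ℓ} → NoInternalSinkSource o
  → ∀ {i j k} → Consecutive i j → Consecutive j k
  → ∀ d → HasInternalSinkSource (setEdge o j d) → Opposite (o i) d ⊎ Opposite d (o k)
setEdge-sinkSource⇒opposite-neighbour {o = o} none {i} {j} {k} cij cjk d (a , b , cab , s)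
  with proj₁ sinkOrSource⇔opposite s | a ≟ j | b ≟ j
... | _   | yes refl | yes refl = ⊥-elim (1+n≢n (sym cab))
... | opp | yes refl | no b≢a   =
  inj₂ (subst₂ Opposite (setEdge-updated o a d)
                        (trans (setEdge-unchanged o d b≢a) (cong o (consecutive-injectiveʳ cab cjk)))
                        opp)
... | opp | no a≢b   | yes refl =
  inj₁ (subst₂ Opposite (trans (setEdge-unchanged o d a≢b) (cong o (consecutive-injectiveˡ cab cij)))
                        (setEdge-updated o b d)
                        opp)
... | opp | no a≢j   | no b≢j   =
  ⊥-elim (noSinkSource⇒¬opposite none cab
            (subst₂ Opposite (setEdge-unchanged o d a≢j) (setEdge-unchanged o d b≢j) opp))

unmarkable⇒neighbours-opposite
  : ∀ {ℓ} {o : Orientation ℓ} → NoInternalSinkSource o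
  → ∀ {i j k} → Consecutive i j → Consecutive j k → Unmarkable o j → Opposite (o i) (o k)
unmarkable⇒neighbours-opposite none cij cjk (_ , sinkSource-fwd , sinkSource-bwd) =
  opposite-of-both (setEdge-sinkSource⇒opposite-neighbour none cij cjk fwd sinkSource-fwd)
                   (setEdge-sinkSource⇒opposite-neighbour none cij cjk bwd sinkSource-bwd)

length-filter-map : ∀ {a b p} {A : Set a} {B : Set b} {P : Pred B p} (P? : Decidable P)
                    (f : A → B) xs → length (filter P? (map f xs)) ≡ length (filter (P? ∘ f) xs)
length-filter-map P? f []       = refl
length-filter-map P? f (x ∷ xs) with P? (f x)
... | yes _ = cong suc (length-filter-map P? f xs)
... | no _  = length-filter-map P? f xs

numUndirected-tail : ∀ {n} (o : Orientation (suc n))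
                   → length (filter (λ k → o k ≟D undir) (tabulate suc)) ≡ numUndirected (o ∘ suc)
numUndirected-tail {n} o =
  trans (cong (length ∘ filter (λ k → o k ≟D undir)) (sym (map-tabulate (λ k → k) suc)))
        (length-filter-map (λ k → o k ≟D undir) suc (allFin n))

numUndirected-undir : ∀ {n} (o : Orientation (suc n)) → o zero ≡ undir
                    → numUndirected o ≡ suc (numUndirected (o ∘ suc))
numUndirected-undir o o₀≡undir =
  trans (cong length (filter-accept (λ k → o k ≟D undir) o₀≡undir))
        (cong suc (numUndirected-tail o))

numUndirected-directed : ∀ {n} (o : Orientation (suc n)) → o zero ≢ undir
                       → numUndirected o ≡ numUndirected (o ∘ suc)
numUndirected-directed o o₀≢undir =
  trans (cong length (filter-reject (λ k → o k ≟D undir) o₀≢undir))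
        (numUndirected-tail o)

record Consistent {ℓ} (o : Orientation ℓ) : Set where
  field
    keeps : ∀ {i j} → Consecutive i j → o i ≢ undir → o j ≢ undir → o i ≡ o j
    flips : ∀ {i j k} → Consecutive i j → Consecutive j k → o j ≡ undir → Opposite (o i) (o k)

open Consistent

consistent : ∀ {ℓ} {o : Orientation ℓ} → NoInternalSinkSource o
           → (∀ k → o k ≡ undir → Unmarkable o k) → Consistent o
consistent none unmarkable = record
  { keeps = λ cij oᵢ≢undir oⱼ≢undir →
      directed∧¬opposite⇒≡ oᵢ≢undir oⱼ≢undir (noSinkSource⇒¬opposite none cij)
  ; flips = λ cij cjk oⱼ≡undir →
      unmarkable⇒neighbours-opposite none cij cjk (unmarkable _ oⱼ≡undir)
  }

consistent-tail : ∀ {ℓ} {o : Orientation (suc ℓ)} → Consistent o → Consistent (o ∘ suc)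
consistent-tail c = record
  { keeps = λ cij → keeps c (cong suc cij)
  ; flips = λ cij cjk → flips c (cong suc cij) (cong suc cjk)
  }

last≡reverse^numUndirected
  : ∀ n (o : Orientation (suc n)) → Consistent o → o zero ≢ undir → o (fromℕ n) ≢ undir
  → o (fromℕ n) ≡ reverse^ (numUndirected o) (o zero)
last≡reverse^numUndirected zero o _ o₀≢undir _ =
  cong (λ m → reverse^ m (o zero)) (sym (numUndirected-directed o o₀≢undir))
last≡reverse^numUndirected (suc n) o c o₀≢undir oₗ≢undir with o (suc zero) ≟D undir
... | no o₁≢undir = begin
  o (fromℕ (suc n))
    ≡⟨ last≡reverse^numUndirected n (o ∘ suc) (consistent-tail c) o₁≢undir oₗ≢undir ⟩
  reverse^ (numUndirected (o ∘ suc)) (o (suc zero))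
    ≡⟨ cong (reverse^ (numUndirected (o ∘ suc)))
            (sym (keeps c {zero} {suc zero} refl o₀≢undir o₁≢undir)) ⟩
  reverse^ (numUndirected (o ∘ suc)) (o zero)
    ≡⟨ cong (λ m → reverse^ m (o zero)) (sym (numUndirected-directed o o₀≢undir)) ⟩
  reverse^ (numUndirected o) (o zero)
    ∎
  where open ≡-Reasoning
last≡reverse^numUndirected (suc zero) o c o₀≢undir oₗ≢undir | yes o₁≡undir =
  ⊥-elim (oₗ≢undir o₁≡undir)
last≡reverse^numUndirected (suc (suc n)) o c o₀≢undir oₗ≢undir | yes o₁≡undir = begin
  o (fromℕ (suc (suc n)))
    ≡⟨ last≡reverse^numUndirected n tail₂ (consistent-tail (consistent-tail c))
                                   (opposite⇒directedʳ o₀-opp-o₂) oₗ≢undir ⟩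
  reverse^ (numUndirected tail₂) (o (suc (suc zero)))
    ≡⟨ cong (reverse^ (numUndirected tail₂)) (opposite⇒≡reverse o₀-opp-o₂) ⟩
  reverse^ (suc (numUndirected tail₂)) (o zero)
    ≡⟨ cong (λ m → reverse^ m (o zero))
            (sym (trans (numUndirected-directed o o₀≢undir)
                        (numUndirected-undir (o ∘ suc) o₁≡undir))) ⟩
  reverse^ (numUndirected o) (o zero)
    ∎
  where
  open ≡-Reasoning
  tail₂ : Orientation (suc n)
  tail₂ k = o (suc (suc k))
  o₀-opp-o₂ : Opposite (o zero) (o (suc (suc zero)))
  o₀-opp-o₂ = flips c {zero} {suc zero} {suc (suc zero)} refl refl o₁≡undir

lemma1 : (n : ℕ) (o : Orientation (suc n))
    → NoInternalSinkSource o
    → o zero ≢ undir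
    → o (fromℕ n) ≢ undir
    → (∀ k → o k ≡ undir → Unmarkable o k)
    → (o zero ≡ o (fromℕ n) → numUndirected o % 2 ≡ 0)
      × (o zero ≢ o (fromℕ n) → numUndirected o % 2 ≡ 1)
lemma1 n o none o₀≢undir oₗ≢undir unmarkable
  rewrite last≡reverse^numUndirected n o (consistent none unmarkable) o₀≢undir oₗ≢undir
  = reverse^-parity (numUndirected o) o₀≢undir
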